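{- Let $D$ be an in-semicomplete digraph, $k$ a positive integer, and $\mathcal{P}$ a $k$-pack of $D$. Then there exists either (i) a coloring of $D$ orthogonal to $\mathcal{P}$, or (ii) a $k$-pack $\mathcal{Q}$ of $D$ such that $\|\mathcal{Q}\| = \|\mathcal{P}\| + 1$ and $e(\mathcal{Q}) \subseteq e(\mathcal{P}) \cup (V(D)\setminus V(\mathcal{P}))$, where $V(\mathcal{P})$ is the set of vertices covered by the paths of $\mathcal{P}$.
   Context: Digraphs are finite, without loops or parallel arcs (directed 2-cycles allowed). Vertices $u,v$ are adjacent if $uv$ or $vu$ is an arc. A digraph is semicomplete if every two distinct vertices are adjacent; $D$ is (locally) in-semicomplete if for every vertex $v$ the in-neighborhood $\{u : uv \in A(D)\}$ induces a semicomplete digraph. A path is a nonempty sequence $v_1\dots v_\ell$ of distinct vertices with $v_iv_{i+1}\in A(D)$; its end is $e(P)=v_\ell$. A $k$-pack of $D$ is a set of at most $k$ pairwise vertex-disjoint paths of $D$; its weight $\|\mathcal{P}\|$ is the number of vertices covered by its paths. For a set $\mathcal{P}$ of paths, $e(\mathcal{P})=\{e(P):P\in\mathcal{P}\}$. A set of vertices is stable if its vertices are pairwise nonadjacent. A coloring of $D$ is a partition of $V(D)$ into stable sets (color classes). A coloring $\mathcal{C}$ and a $k$-pack $\mathcal{P}$ are orthogonal if each color class $C\in\mathcal{C}$ meets $\min\{|C|,k\}$ distinct paths of $\mathcal{P}$. -}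

module Defs where

open import Level using (0ℓ)
open import Data.Nat using (ℕ; _≤_; _+_; _⊓_)
open import Data.Nat.Properties using (_≟_)
open import Data.Fin using (Fin)
open import Data.Fin.Properties using () renaming (_≟_ to _≟ᶠ_)
open import Data.List using (List; []; _∷_; length; map; filter; allFin)
open import Data.Nat.ListAction using (sum)
open import Data.List.NonEmpty using (List⁺; _∷_; toList; last)
open import Data.List.Relation.Unary.Any using (Any; any?)
open import Data.List.Relation.Unary.Unique.Propositional using (Unique)
open import Data.List.Relation.Unary.AllPairs using (AllPairs)
open import Data.List.Membership.Propositional using (_∈_)
open import Data.Product using (Σ; _×_; _,_)
open import Data.Sum using (_⊎_)
open import Data.Empty using (⊥)
open import Relation.Nullary using (¬_; Dec)
open import Relation.Binary.PropositionalEquality using (_≡_; _≢_)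

-- A finite digraph on vertex set Fin n; arcs form a decidable relation,
-- no loops (parallel arcs are excluded automatically, 2-cycles allowed).
record Digraph : Set₁ where
  field
    n     : ℕ
    Arc   : Fin n → Fin n → Set
    arc?  : ∀ u v → Dec (Arc u v)
    noLoop : ∀ v → ¬ Arc v v
open Digraph public

Vertex : Digraph → Set
Vertex D = Fin (n D)

Adjacent : (D : Digraph) → Vertex D → Vertex D → Set
Adjacent D u v = Arc D u v ⊎ Arc D v u

InSemicomplete : Digraph → Set
InSemicomplete D = ∀ (v x y : Vertex D) → Arc D x v → Arc D y v → x ≢ y → Adjacent D x y

Walk : (D : Digraph) → List (Vertex D) → Set
Walk D []            = Data.Unit.⊤ where import Data.Unit
Walk D (x ∷ [])      = Data.Unit.⊤ where import Data.Unit
Walk D (x ∷ y ∷ xs)  = Arc D x y × Walk D (y ∷ xs)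

record Path (D : Digraph) : Set where
  constructor mkPath
  field
    verts    : List⁺ (Vertex D)
    distinct : Unique (toList verts)
    arcs     : Walk D (toList verts)
open Path public

end : ∀ {D} → Path D → Vertex D
end P = last (verts P)

_∈ᵖ_ : ∀ {D} → Vertex D → Path D → Set
v ∈ᵖ P = v ∈ toList (verts P)

Disjoint : ∀ {D} → Path D → Path D → Set
Disjoint P Q = ∀ v → v ∈ᵖ P → v ∈ᵖ Q → ⊥

IsPack : (D : Digraph) → ℕ → List (Path D) → Set
IsPack D k Ps = (length Ps ≤ k) × AllPairs Disjoint Ps

weight : ∀ {D} → List (Path D) → ℕ
weight Ps = sum (map (λ P → Data.List.NonEmpty.length (verts P)) Ps)

Covered : ∀ {D} → Vertex D → List (Path D) → Set
Covered v Ps = Any (v ∈ᵖ_) Ps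

IsEndOf : ∀ {D} → Vertex D → List (Path D) → Set
IsEndOf v Ps = v ∈ map end Ps

-- A coloring given by a color assignment; color classes are its fibres,
-- which must be stable sets.
IsColoring : (D : Digraph) → (Vertex D → ℕ) → Set
IsColoring D c = ∀ u v → c u ≡ c v → ¬ Adjacent D u v

classSize : ∀ {D} → (Vertex D → ℕ) → ℕ → ℕ
classSize {D} c j = length (filter (λ v → c v ≟ j) (allFin (n D)))

meets : ∀ {D} → (Vertex D → ℕ) → ℕ → List (Path D) → ℕ
meets c j Ps = length (filter (λ P → any? (λ v → c v ≟ j) (toList (verts P))) Ps)

Orthogonal : ∀ {D} → ℕ → (Vertex D → ℕ) → List (Path D) → Set
Orthogonal {D} k c Ps = ∀ (v : Vertex D) → meets {D} c (c v) Ps ≡ classSize {D} c (c v) ⊓ k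

{-# OPTIONS --safe #-}
-- Let U be the set of vertices missed by the pack P. Heights h ≥ 1 on U are maintained so that every u ∈ U with
-- h(u) ≥ 2 has an out-neighbour in U of height h(u) − 1; following these arcs gives a path of D[U] on h(u)
-- vertices starting at u. While an arc of D[U] joins two vertices of equal height, raising every vertex that
-- descends to its tail keeps this property, so (as for Gallai–Roy) the heights become proper unless one exceeds ‖P‖.
-- Colour u ∈ U by h(u), a covered vertex by its distance (in vertices) to the end of its path when that distance
-- is the height of some uncovered vertex, and every other vertex by a colour of its own.
-- Unless this colouring is proper and orthogonal to P, a local move yields a k-pack of weight ‖P‖ + 1 ending in
-- old ends or uncovered vertices: add a one-vertex path if there are fewer than k paths; insert an uncovered vertex
-- into a path it dominates (in-semicompleteness orients the arc from the preceding vertex); follow a path up to a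
-- vertex v at distance h(u) and continue along the path of D[U] from u, if v → u; absorb a path up to x into
-- another path that x dominates and replace the part after x by a path of D[U], if the distance of x is a height;
-- replace a path shorter than some height by a path of D[U]. Otherwise every path is at least as long as every
-- height, so an even colour class meets all k paths and has at least k vertices, while odd classes are single
-- covered vertices.

module Submission where

open import Defs
open import Data.Nat using (ℕ; zero; suc; pred; _≤_; _<_; _+_; _*_; _∸_; _⊓_; s≤s; z≤n; _≤?_; _<?_; >-nonZero)
open import Data.Nat.Properties using (_≟_; ≤-refl; ≤-reflexive; ≤-trans; ≤-antisym; ≤-pred; <-trans; <-irrefl;
  ≤-<-trans; ≮⇒≥; ≰⇒>; ≤∧≢⇒<; suc-injective; suc-pred; n≤1+n; m≤m+n; m≤n+m; m+1+n≢n; m∸n+n≡m; +-comm;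
  +-mono-≤; +-mono-<-≤; +-mono-≤-<; ∸-monoʳ-≤; ∸-monoʳ-<; *-cancelˡ-≡; even≢odd; m≥n⇒m⊓n≡n; m≤n⇒m⊓n≡m)
open import Data.Nat.Induction using (<-wellFounded)
open import Data.Nat.ListAction using (sum)
open import Data.Nat.ListAction.Properties using (sum-++; sum-↭)
open import Data.Nat.Solver using (module +-*-Solver)
open import Data.Fin using (toℕ)
open import Data.Fin.Properties using (toℕ-injective) renaming (_≟_ to _≟ᶠ_; any? to anyᶠ?)
open import Data.List using (List; []; _∷_; _++_; [_]; length; map; filter; allFin; initLast; _∷ʳ′_)
open import Data.List.Properties using (∷-injectiveˡ; ∷-injectiveʳ; ++-assoc; length-++; map-++;
  filter-accept; filter-reject; filter-none; filter-all)
open import Data.List.NonEmpty using (List⁺; _∷_; last; toList; head)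
import Data.List.NonEmpty as List⁺
open import Data.List.Relation.Unary.Any using (Any; here; there; any?)
import Data.List.Relation.Unary.Any as Any
open import Data.List.Relation.Unary.All using (All; []; _∷_)
import Data.List.Relation.Unary.All as All
import Data.List.Relation.Unary.All.Properties as All
open import Data.List.Relation.Unary.AllPairs using (AllPairs; []; _∷_)
import Data.List.Relation.Unary.AllPairs as AllPairs
import Data.List.Relation.Unary.AllPairs.Properties as AllPairs
open import Data.List.Relation.Unary.Unique.Propositional using (Unique)
import Data.List.Relation.Unary.Unique.Propositional.Properties as Unique
open import Data.List.Membership.Propositional using (_∈_; _∉_; find; lose)
open import Data.List.Membership.Propositional.Properties using (∈-∃++; ∈-++⁻; ∈-++⁺ˡ; ∈-++⁺ʳ; ∈-insert;
  ∈-map⁺; ∈-filter⁺; ∈-allFin)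
open import Data.List.Relation.Binary.Permutation.Propositional using (_↭_; ↭-refl; ↭-sym; ↭-trans; ↭-prep; ↭⇒↭ₛ)
open import Data.List.Relation.Binary.Permutation.Propositional.Properties using (shift; ↭-length; map⁺;
  Any-resp-↭; ∈-resp-↭)
import Data.List.Relation.Binary.Permutation.Setoid.Properties as PermProperties
open import Data.Product using (Σ; ∃; ∃₂; _×_; _,_; proj₁; proj₂)
open import Data.Sum using (_⊎_; inj₁; inj₂; map₁)
import Data.Sum
open import Data.Unit using (tt)
open import Data.Empty using (⊥; ⊥-elim)
open import Function using (_∘_; case_of_)
open import Induction.WellFounded using (Acc; acc)
open import Relation.Unary using (Decidable)
open import Relation.Nullary using (¬_; Dec; yes; no; contradiction)
open import Relation.Nullary.Decidable using (_×-dec_; _⊎-dec_; ¬?; map′)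
open import Relation.Binary.PropositionalEquality using (_≡_; _≢_; refl; sym; trans; cong; cong₂; subst; subst₂;
  setoid; resp₂; module ≡-Reasoning)

module _ {A : Set} where

  last-∷ : (x y : A) (ys : List A) → last (x ∷ y ∷ ys) ≡ last (y ∷ ys)
  last-∷ x y ys with initLast ys
  ... | [] = refl
  ... | _ ∷ʳ′ _ = refl

  last-++ : (x : A) (xs : List A) (y : A) (ys : List A) → last (x ∷ xs ++ y ∷ ys) ≡ last (y ∷ ys)
  last-++ x [] y ys = last-∷ x y ys
  last-++ x (z ∷ zs) y ys = trans (last-∷ x z (zs ++ y ∷ ys)) (last-++ z zs y ys)

  last-∈ : (x : A) (xs : List A) → last (x ∷ xs) ∈ x ∷ xs
  last-∈ x [] = here refl
  last-∈ x (y ∷ ys) = there (subst (_∈ y ∷ ys) (sym (last-∷ x y ys)) (last-∈ y ys))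

  last-split : ∀ (xs : List⁺ A) pre {s suf} → toList xs ≡ pre ++ s ∷ suf → last xs ≡ last (s ∷ suf)
  last-split (x ∷ xs) [] refl = refl
  last-split (x ∷ xs) (p ∷ pre) refl = last-++ p pre _ _

  ∷-position-injective : ∀ (p : List A) {x} s p′ {y} s′ → p ++ x ∷ s ≡ p′ ++ y ∷ s′ → length s ≡ length s′ → x ≡ y
  ∷-position-injective [] s [] s′ eq _ = ∷-injectiveˡ eq
  ∷-position-injective [] s (_ ∷ p′) s′ eq l =
    contradiction (trans (sym (length-++ p′)) (trans (cong length (sym (∷-injectiveʳ eq))) l)) (m+1+n≢n _)
  ∷-position-injective (_ ∷ p) s [] s′ eq l =
    contradiction (trans (sym (length-++ p)) (trans (cong length (∷-injectiveʳ eq)) (sym l))) (m+1+n≢n _)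
  ∷-position-injective (_ ∷ p) s (_ ∷ p′) s′ eq l = ∷-position-injective p s p′ s′ (∷-injectiveʳ eq) l

  split-at-suffix-length : ∀ (xs : List A) m → m < length xs → ∃₂ λ p x → ∃ λ s → xs ≡ p ++ x ∷ s × length s ≡ m
  split-at-suffix-length (y ∷ ys) m m<∣xs∣ with m ≟ length ys
  ... | yes refl = [] , y , ys , refl , refl
  ... | no m≢∣ys∣ with split-at-suffix-length ys m (≤∧≢⇒< (≤-pred m<∣xs∣) m≢∣ys∣)
  ...   | p , x , s , refl , ∣s∣≡m = y ∷ p , x , s , refl , ∣s∣≡m

  private
    Unique-resp-↭ : ∀ {xs ys} → xs ↭ ys → Unique xs → Unique ys
    Unique-resp-↭ p = PermProperties.Unique-resp-↭ (setoid A) (↭⇒↭ₛ p)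

  Unique-insert : ∀ (xs : List A) {u ys} → Unique (xs ++ ys) → u ∉ xs ++ ys → Unique (xs ++ u ∷ ys)
  Unique-insert xs {u} {ys} uniq u∉ =
    Unique-resp-↭ (↭-sym (shift u xs ys)) (All.tabulate (λ u∈ u≡ → u∉ (subst (_∈ _) (sym u≡) u∈)) ∷ uniq)

  Unique-split⇒∉ : ∀ (p : List A) {x s} → Unique (p ++ x ∷ s) → x ∉ p
  Unique-split⇒∉ p {x} {s} uniq x∈p with Unique-resp-↭ (shift x p s) uniq
  ... | x∉ ∷ _ = All.lookup x∉ (∈-++⁺ˡ x∈p) refl

  Unique-++⁻ˡ : ∀ (xs : List A) {ys} → Unique (xs ++ ys) → Unique xs
  Unique-++⁻ˡ [] _ = []
  Unique-++⁻ˡ (x ∷ xs) (x∉ ∷ uniq) = All.++⁻ˡ xs x∉ ∷ Unique-++⁻ˡ xs uniq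

  Unique⇒length≤ : ∀ {xs ys : List A} → Unique xs → (∀ {z} → z ∈ xs → z ∈ ys) → length xs ≤ length ys
  Unique⇒length≤ [] _ = z≤n
  Unique⇒length≤ {x ∷ xs} (x∉ ∷ uniq) xs⊆ys with ∈-∃++ (xs⊆ys (here refl))
  ... | p , s , refl = subst (suc (length xs) ≤_) (sym (↭-length (shift x p s)))
        (s≤s (Unique⇒length≤ uniq λ z∈ → drop-x (∈-resp-↭ (shift x p s) (xs⊆ys (there z∈))) (All.lookup x∉ z∈)))
    where
    drop-x : ∀ {z} → z ∈ x ∷ p ++ s → x ≢ z → z ∈ p ++ s
    drop-x (here refl) x≢z = contradiction refl x≢z
    drop-x (there z∈) _ = z∈

  ∈⇒↭ : ∀ {x : A} {xs} → x ∈ xs → ∃ λ ys → xs ↭ x ∷ ys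
  ∈⇒↭ {x} x∈ with ∈-∃++ x∈
  ... | p , s , refl = p ++ s , shift x p s

  sum-map-< : ∀ (f g : A → ℕ) {u xs} → (∀ x → f x ≤ g x) → u ∈ xs → f u < g u →
    sum (map f xs) < sum (map g xs)
  sum-map-< f g {xs = x ∷ xs} f≤g (here refl) fu<gu = +-mono-<-≤ fu<gu (sum-map-≤ xs)
    where
    sum-map-≤ : ∀ xs → sum (map f xs) ≤ sum (map g xs)
    sum-map-≤ [] = z≤n
    sum-map-≤ (x ∷ xs) = +-mono-≤ (f≤g x) (sum-map-≤ xs)
  sum-map-< f g {xs = x ∷ xs} f≤g (there u∈) fu<gu = +-mono-≤-< (f≤g x) (sum-map-< f g f≤g u∈ fu<gu)

  filter-length-1 : ∀ {P : A → Set} (P? : Decidable P) {xs} → AllPairs (λ a b → ¬ (P a × P b)) xs → Any P xs →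
    length (filter P? xs) ≡ 1
  filter-length-1 P? (a∦ ∷ _) (here Pa) =
    trans (cong length (filter-accept P? Pa)) (cong (suc ∘ length) (filter-none P? (All.map (λ ¬both → ¬both ∘ (Pa ,_)) a∦)))
  filter-length-1 P? (a∦ ∷ ∦) (there any) =
    trans (cong length (filter-reject P? λ Pa → All.All¬⇒¬Any (All.map (λ ¬both → ¬both ∘ (Pa ,_)) a∦) any))
      (filter-length-1 P? ∦ any)

  ∃-∈ : ∀ {xs : List A} → 1 ≤ length xs → ∃ (_∈ xs)
  ∃-∈ {x ∷ _} _ = x , here refl

-- Paths

module _ {D : Digraph} where

  open import Data.List.Membership.DecPropositional (_≟ᶠ_ {n D}) using (_∈?_)

  private
    V = Vertex D

  vertices : Path D → List V
  vertices Q = toList (verts Q)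

  start : Path D → V
  start Q = head (verts Q)

  size : Path D → ℕ
  size Q = Data.List.NonEmpty.length (verts Q)

  singleton : V → Path D
  singleton u = mkPath (u ∷ []) ([] ∷ []) tt

  pathOf : ∀ pre s suf → Unique (pre ++ s ∷ suf) → Walk D (pre ++ s ∷ suf) → Σ (Path D) λ Q → vertices Q ≡ pre ++ s ∷ suf
  pathOf [] s suf uniq walk = mkPath (s ∷ suf) uniq walk , refl
  pathOf (p ∷ pre) s suf uniq walk = mkPath (p ∷ pre ++ s ∷ suf) uniq walk , refl

  end-split : ∀ (Q : Path D) pre {s suf} → vertices Q ≡ pre ++ s ∷ suf → end Q ≡ last (s ∷ suf)
  end-split Q = last-split (verts Q)

  end∈ : (Q : Path D) → end Q ∈ᵖ Q
  end∈ Q = last-∈ (start Q) (List⁺.tail (verts Q))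

  Walk-++⁻ˡ : ∀ xs {ys} → Walk D (xs ++ ys) → Walk D xs
  Walk-++⁻ˡ [] _ = tt
  Walk-++⁻ˡ (x ∷ []) _ = tt
  Walk-++⁻ˡ (x ∷ y ∷ xs) (xy , walk) = xy , Walk-++⁻ˡ (y ∷ xs) walk

  Walk-++ : ∀ x xs {y ys} → Walk D (x ∷ xs) → Arc D (last (x ∷ xs)) y → Walk D (y ∷ ys) → Walk D (x ∷ xs ++ y ∷ ys)
  Walk-++ x [] _ xy walk = xy , walk
  Walk-++ x (x′ ∷ xs) (xx′ , walk) ly walk′ = xx′ , Walk-++ x′ xs walk (subst (λ l → Arc D l _) (last-∷ x x′ xs) ly) walk′

  initial-segment : ∀ (Q : Path D) p {x s} → vertices Q ≡ p ++ x ∷ s →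
    Σ (Path D) λ P → size P ≡ suc (length p) × end P ≡ x × (∀ {z} → z ∈ᵖ P → z ∈ᵖ Q)
  initial-segment Q p {x} {s} Q≡ =
    let P , P≡ = pathOf p x [] (Unique-++⁻ˡ (p ++ [ x ]) uniq) (Walk-++⁻ˡ (p ++ [ x ]) walk)
    in P , trans (cong length P≡) (trans (length-++ p) (+-comm (length p) 1)) , end-split P p P≡ ,
       λ {z} z∈P → subst (z ∈_) (sym Q≡′) (∈-++⁺ˡ (subst (z ∈_) P≡ z∈P))
    where
    Q≡′ : vertices Q ≡ (p ++ [ x ]) ++ s
    Q≡′ = trans Q≡ (sym (++-assoc p [ x ] s))
    uniq = subst Unique Q≡′ (distinct Q)
    walk = subst (Walk D) Q≡′ (arcs Q)

  join : (P C : Path D) → Disjoint P C → Arc D (end P) (start C) →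
    Σ (Path D) λ R → vertices R ≡ vertices P ++ vertices C × end R ≡ end C
  join P@(mkPath (p ∷ ps) uniqP walkP) C@(mkPath (c ∷ cs) uniqC walkC) P∩C pc =
    mkPath (p ∷ ps ++ c ∷ cs) (Unique.++⁺ uniqP uniqC λ (z∈P , z∈C) → P∩C _ z∈P z∈C) (Walk-++ p ps walkP pc walkC) ,
    refl , last-++ p ps c cs

  lengthFrom : V → List V → ℕ
  lengthFrom x [] = 0
  lengthFrom x (z ∷ zs) with x ≟ᶠ z
  ... | yes _ = suc (length zs)
  ... | no _ = lengthFrom x zs

  lengthFrom-split : ∀ p {x s} → x ∉ p → lengthFrom x (p ++ x ∷ s) ≡ suc (length s)
  lengthFrom-split [] {x} _ with x ≟ᶠ x
  ... | yes _ = refl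
  ... | no x≢x = contradiction refl x≢x
  lengthFrom-split (z ∷ p) {x} x∉ with x ≟ᶠ z
  ... | yes x≡z = contradiction (here x≡z) x∉
  ... | no _ = lengthFrom-split p (λ x∈ → x∉ (there x∈))

  distanceToEnd : List (Path D) → V → ℕ
  distanceToEnd [] x = 0
  distanceToEnd (Q ∷ Qs) x with x ∈? vertices Q
  ... | yes _ = lengthFrom x (vertices Q)
  ... | no _ = distanceToEnd Qs x

  distanceToEnd-split : ∀ {Qs Q} p {x s} → AllPairs Disjoint Qs → Q ∈ Qs → vertices Q ≡ p ++ x ∷ s →
    distanceToEnd Qs x ≡ suc (length s)
  distanceToEnd-split {Q ∷ Qs} p {x} _ (here refl) Q≡ with x ∈? vertices Q
  ... | yes _ = trans (cong (lengthFrom x) Q≡) (lengthFrom-split p (Unique-split⇒∉ p (subst Unique Q≡ (distinct Q))))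
  ... | no x∉ = contradiction (subst (x ∈_) (sym Q≡) (∈-insert p)) x∉
  distanceToEnd-split {R ∷ Qs} p {x} (R∩Qs ∷ disjoint) (there Q∈) Q≡ with x ∈? vertices R
  ... | yes x∈R = ⊥-elim (All.lookup R∩Qs Q∈ x x∈R (subst (x ∈_) (sym Q≡) (∈-insert p)))
  ... | no _ = distanceToEnd-split p disjoint Q∈ Q≡

module Insertion {D : Digraph} (in-semicomplete : InSemicomplete D) where

  private
    V = Vertex D

  -- u goes right before the first vertex it dominates; the vertex preceding that one
  -- shares an out-neighbour with u, so in-semicompleteness orients it towards u.
  insert-before : ∀ u xs → Walk D xs → u ∉ xs → Any (Arc D u) xs →
    ∃₂ λ pre s → ∃ λ suf → xs ≡ pre ++ s ∷ suf × Walk D (pre ++ u ∷ s ∷ suf)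
  insert-before u (x ∷ xs) walk u∉ u→xs with arc? D u x
  ... | yes ux = [] , x , xs , refl , ux , walk
  insert-before u (x ∷ xs) walk u∉ (here ux) | no ¬ux = contradiction ux ¬ux
  insert-before u (x ∷ x′ ∷ xs) (xx′ , walk) u∉ (there u→xs) | no ¬ux
    with insert-before u (x′ ∷ xs) walk (λ u∈ → u∉ (there u∈)) u→xs
  ... | [] , _ , _ , refl , ux′ , walk′ = x ∷ [] , x′ , xs , refl , xu , ux′ , walk′
    where
    xu : Arc D x u
    xu with in-semicomplete x′ x u xx′ ux′ (λ x≡u → u∉ (here (sym x≡u)))
    ... | inj₁ xu = xu
    ... | inj₂ ux = contradiction ux ¬ux
  ... | _ ∷ pre , s , suf , refl , walk′ = x ∷ x′ ∷ pre , s , suf , refl , xx′ , walk′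

  insert : ∀ {u} (Q : Path D) → u ∉ vertices Q → Any (Arc D u) (vertices Q) →
    Σ (Path D) λ Q′ → vertices Q′ ↭ u ∷ vertices Q × end Q′ ≡ end Q
  insert {u} Q u∉ u→Q with insert-before u (vertices Q) (arcs Q) u∉ u→Q
  ... | pre , s , suf , Q≡ , walk with pathOf pre u (s ∷ suf) uniq walk
    where
    uniq = Unique-insert pre (subst Unique Q≡ (distinct Q)) (subst (u ∉_) Q≡ u∉)
  ... | Q′ , Q′≡ = Q′ , subst₂ _↭_ (sym Q′≡) (cong (u ∷_) (sym Q≡)) (shift u pre (s ∷ suf)) ,
                   trans (end-split Q′ pre Q′≡) (trans (last-∷ u s suf) (sym (end-split Q pre Q≡)))

  absorb-list : ∀ p ps (Q : Path D) → Walk D (p ∷ ps) → Unique (p ∷ ps) → (∀ {z} → z ∈ p ∷ ps → z ∉ vertices Q) →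
    Any (Arc D (last (p ∷ ps))) (vertices Q) →
    Σ (Path D) λ Q′ → vertices Q′ ↭ (p ∷ ps) ++ vertices Q × end Q′ ≡ end Q
  absorb-list p [] Q _ _ disj p→Q = insert Q (disj (here refl)) p→Q
  absorb-list p (q ∷ ps) Q (pq , walk) (p∉ ∷ uniq) disj l→Q
    with absorb-list q ps Q walk uniq (λ z∈ → disj (there z∈)) (subst (λ l → Any (Arc D l) (vertices Q)) (last-∷ p q ps) l→Q)
  ... | Q″ , Q″↭ , end≡ with insert Q″ p∉Q″ (Any-resp-↭ (↭-sym Q″↭) (here pq))
    where
    p∉Q″ : p ∉ vertices Q″
    p∉Q″ p∈ with ∈-++⁻ (q ∷ ps) (∈-resp-↭ Q″↭ p∈)
    ... | inj₁ p∈ps = All.lookup p∉ p∈ps refl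
    ... | inj₂ p∈Q = disj (here refl) p∈Q
  ... | Q′ , Q′↭ , end≡′ = Q′ , ↭-trans Q′↭ (↭-prep p Q″↭) , trans end≡′ end≡

  absorb : (P Q : Path D) → Disjoint P Q → Any (Arc D (end P)) (vertices Q) →
    Σ (Path D) λ Q′ → vertices Q′ ↭ vertices P ++ vertices Q × end Q′ ≡ end Q
  absorb (mkPath (p ∷ ps) uniq walk) Q P∩Q = absorb-list p ps Q walk uniq (λ z∈P z∈Q → P∩Q _ z∈P z∈Q)

-- Augmenting a pack

module _ {D : Digraph} where

  weight-++ : (Qs Rs : List (Path D)) → weight (Qs ++ Rs) ≡ weight Qs + weight Rs
  weight-++ Qs Rs = trans (cong sum (map-++ size Qs Rs)) (sum-++ (map size Qs) (map size Rs))

  weight-↭ : ∀ {Qs Rs : List (Path D)} → Qs ↭ Rs → weight Qs ≡ weight Rs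
  weight-↭ Qs↭Rs = sum-↭ (map⁺ size Qs↭Rs)

  size≤weight : ∀ {Q : Path D} {Qs} → Q ∈ Qs → size Q ≤ weight Qs
  size≤weight {Qs = Q ∷ Qs} (here refl) = m≤m+n (size Q) (weight Qs)
  size≤weight {Qs = R ∷ Qs} (there Q∈) = ≤-trans (size≤weight Q∈) (m≤n+m (weight Qs) (size R))

  Disjoint-sym : ∀ {P Q : Path D} → Disjoint P Q → Disjoint Q P
  Disjoint-sym P∩Q v v∈Q v∈P = P∩Q v v∈P v∈Q

  disjoint-resp-↭ : ∀ {Qs Rs : List (Path D)} → Qs ↭ Rs → AllPairs Disjoint Qs → AllPairs Disjoint Rs
  disjoint-resp-↭ Qs↭Rs = PermProperties.AllPairs-resp-↭ (setoid (Path D)) {R = Disjoint}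
    (λ {P} {Q} → Disjoint-sym {P} {Q}) (resp₂ Disjoint) (↭⇒↭ₛ Qs↭Rs)

  disjoint-++-cross : ∀ Qs {Rs : List (Path D)} {Q R} → AllPairs Disjoint (Qs ++ Rs) → Q ∈ Qs → R ∈ Rs → Disjoint Q R
  disjoint-++-cross (_ ∷ Qs) {Rs} (Q∩ ∷ _) (here refl) R∈ = All.lookup Q∩ (∈-++⁺ʳ Qs {Rs} R∈)
  disjoint-++-cross (_ ∷ Qs) (_ ∷ disjoint) (there Q∈) R∈ = disjoint-++-cross Qs disjoint Q∈ R∈

  disjoint-++⁻ʳ : ∀ (Qs : List (Path D)) {Rs} → AllPairs Disjoint (Qs ++ Rs) → AllPairs Disjoint Rs
  disjoint-++⁻ʳ [] disjoint = disjoint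
  disjoint-++⁻ʳ (_ ∷ Qs) (_ ∷ disjoint) = disjoint-++⁻ʳ Qs disjoint

module Augmentation {D : Digraph} {k : ℕ} {Ps : List (Path D)} (pack : IsPack D k Ps) where

  private
    V = Vertex D

  Augmenting : Set
  Augmenting = Σ (List (Path D)) λ Qs → IsPack D k Qs × (weight Qs ≡ weight Ps + 1)
    × All (λ Q → IsEndOf (end Q) Ps ⊎ ¬ Covered (end Q) Ps) Qs

  Uncovered : V → Set
  Uncovered v = ¬ Covered v Ps

  covered : ∀ {Q v} → Q ∈ Ps → v ∈ᵖ Q → Covered v Ps
  covered Q∈ v∈ = lose Q∈ v∈

  end-of : ∀ {Q} → Q ∈ Ps → IsEndOf (end Q) Ps
  end-of = ∈-map⁺ end

  replace : ∀ Rs Os Ns → Ps ↭ Rs ++ Os → AllPairs Disjoint Ns → length Ns + length Os ≤ k →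
    weight Ns ≡ weight Rs + 1 → (∀ {N z} → N ∈ Ns → z ∈ᵖ N → Covered z Rs ⊎ Uncovered z) →
    All (λ N → IsEndOf (end N) Ps ⊎ Uncovered (end N)) Ns → Augmenting
  replace Rs Os Ns Ps↭ disjointNs length≤ weight≡ inside ends =
    Ns ++ Os , (subst (_≤ k) (sym (length-++ Ns)) length≤ , AllPairs.++⁺ disjointNs (disjoint-++⁻ʳ Rs disjointRsOs) cross) ,
    weight-eq , All.++⁺ ends (All.tabulate λ O∈ → inj₁ (end-of (inPs O∈)))
    where
    disjointRsOs = disjoint-resp-↭ Ps↭ (proj₂ pack)
    inPs : ∀ {O} → O ∈ Os → O ∈ Ps
    inPs O∈ = ∈-resp-↭ (↭-sym Ps↭) (∈-++⁺ʳ Rs O∈)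
    cross : All (λ N → All (Disjoint N) Os) Ns
    cross = All.tabulate λ N∈ → All.tabulate λ O∈ z z∈N z∈O → not-shared (inside N∈ z∈N) O∈ z∈O
      where
      not-shared : ∀ {z O} → Covered z Rs ⊎ Uncovered z → O ∈ Os → z ∈ᵖ O → ⊥
      not-shared (inj₁ z∈Rs) O∈ z∈O with find z∈Rs
      ... | R , R∈ , z∈R = disjoint-++-cross Rs disjointRsOs R∈ O∈ _ z∈R z∈O
      not-shared (inj₂ z∉) O∈ z∈O = z∉ (covered (inPs O∈) z∈O)
    open +-*-Solver
    weight-eq : weight (Ns ++ Os) ≡ weight Ps + 1
    weight-eq = trans (weight-++ Ns Os) (trans (cong (_+ weight Os) weight≡)
      (trans (solve 3 (λ r o one → (r :+ one) :+ o := (r :+ o) :+ one) refl (weight Rs) (weight Os) 1)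
        (cong (_+ 1) (sym (trans (weight-↭ Ps↭) (weight-++ Rs Os))))))

  replace-one : ∀ {Q} → Q ∈ Ps → (Q′ : Path D) → size Q′ ≡ suc (size Q) →
    (∀ {z} → z ∈ᵖ Q′ → z ∈ᵖ Q ⊎ Uncovered z) → IsEndOf (end Q′) Ps ⊎ Uncovered (end Q′) → Augmenting
  replace-one {Q} Q∈ Q′ size≡ inside end′ with ∈⇒↭ Q∈
  ... | Os , Ps↭ = replace [ Q ] Os [ Q′ ] Ps↭ ([] ∷ [])
    (subst (_≤ k) (↭-length Ps↭) (proj₁ pack))
    (trans (cong (_+ 0) size≡) (+-comm 1 (size Q + 0)))
    (λ { (here refl) z∈ → map₁ here (inside z∈) })
    (end′ ∷ [])

  augment-by-singleton : ∀ {u} → Uncovered u → length Ps < k → Augmenting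
  augment-by-singleton {u} u∉ length< =
    replace [] Ps [ singleton u ] ↭-refl ([] ∷ []) length< refl
      (λ { (here refl) (here refl) → inj₂ u∉ }) (inj₂ u∉ ∷ [])

  augment-by-exchange : ∀ {Q} → Q ∈ Ps → (C : Path D) → All Uncovered (vertices C) → size C ≡ suc (size Q) → Augmenting
  augment-by-exchange Q∈ C C-uncovered size≡ =
    replace-one Q∈ C size≡ (λ z∈ → inj₂ (All.lookup C-uncovered z∈)) (inj₂ (All.lookup C-uncovered (end∈ C)))

  augment-by-splicing : ∀ {v} → Covered v Ps → (C : Path D) → All Uncovered (vertices C) → Arc D v (start C) →
    size C ≡ distanceToEnd Ps v → Augmenting
  augment-by-splicing {v} v∈Ps C C-uncovered vC size≡ with find v∈Ps
  ... | Q , Q∈ , v∈Q with ∈-∃++ v∈Q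
  ...   | p , s , Q≡ with initial-segment Q p Q≡
  ...     | P , sizeP , endP≡ , P⊆Q with join P C P∩C (subst (λ x → Arc D x (start C)) (sym endP≡) vC)
    where
    P∩C : Disjoint P C
    P∩C z z∈P z∈C = All.lookup C-uncovered z∈C (covered Q∈ (P⊆Q z∈P))
  ...       | R , R≡ , endR≡ = replace-one Q∈ R size-eq inside
    (inj₂ (subst Uncovered (sym endR≡) (All.lookup C-uncovered (end∈ C))))
    where
    inside : ∀ {z} → z ∈ᵖ R → z ∈ᵖ Q ⊎ Uncovered z
    inside {z} z∈R with ∈-++⁻ (vertices P) (subst (z ∈_) R≡ z∈R)
    ... | inj₁ z∈P = inj₁ (P⊆Q z∈P)
    ... | inj₂ z∈C = inj₂ (All.lookup C-uncovered z∈C)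
    size-eq : size R ≡ suc (size Q)
    size-eq = begin
      size R                          ≡⟨ cong length R≡ ⟩
      length (vertices P ++ vertices C) ≡⟨ length-++ (vertices P) ⟩
      size P + size C                 ≡⟨ cong₂ _+_ sizeP (trans size≡ (distanceToEnd-split p (proj₂ pack) Q∈ Q≡)) ⟩
      suc (length p + suc (length s)) ≡⟨ cong suc (sym (length-++ p)) ⟩
      suc (length (p ++ v ∷ s))       ≡⟨ cong (suc ∘ length) (sym Q≡) ⟩
      suc (size Q)                    ∎
      where open ≡-Reasoning

  SamePath : V → V → Set
  SamePath x y = Any (λ R → x ∈ᵖ R × y ∈ᵖ R) Ps

  separate : ∀ {x y} → Covered x Ps → Covered y Ps → ¬ SamePath x y →
    ∃ λ Qa → ∃ λ Qb → ∃ λ Os → Ps ↭ Qa ∷ Qb ∷ Os × x ∈ᵖ Qa × y ∈ᵖ Qb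
  separate {x} {y} x∈Ps y∈Ps ¬same with find x∈Ps
  ... | Qa , Qa∈ , x∈Qa with ∈⇒↭ Qa∈
  ...   | rest , Ps↭ with Any-resp-↭ Ps↭ y∈Ps
  ...     | here y∈Qa = contradiction (lose Qa∈ (x∈Qa , y∈Qa)) ¬same
  ...     | there y∈rest with find y∈rest
  ...       | Qb , Qb∈ , y∈Qb with ∈⇒↭ Qb∈
  ...         | Os , rest↭ = Qa , Qb , Os , ↭-trans Ps↭ (↭-prep Qa rest↭) , x∈Qa , y∈Qb

  module _ (in-semicomplete : InSemicomplete D) where

    open Insertion {D} in-semicomplete

    augment-by-insertion : ∀ {u v} → Uncovered u → Covered v Ps → Arc D u v → Augmenting
    augment-by-insertion {u} u∉ v∈Ps uv with find v∈Ps
    ... | Q , Q∈ , v∈Q with insert Q (λ u∈Q → u∉ (covered Q∈ u∈Q)) (lose v∈Q uv)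
    ...   | Q′ , Q′↭ , end≡ =
      replace-one Q∈ Q′ (↭-length Q′↭) inside (inj₁ (subst (λ e → IsEndOf e Ps) (sym end≡) (end-of Q∈)))
      where
      inside : ∀ {z} → z ∈ᵖ Q′ → z ∈ᵖ Q ⊎ Uncovered z
      inside z∈ with ∈-resp-↭ Q′↭ z∈
      ... | here refl = inj₂ u∉
      ... | there z∈Q = inj₁ z∈Q

    augment-by-rerouting : ∀ {x y} → Covered x Ps → Covered y Ps → ¬ SamePath x y → Arc D x y →
      (C : Path D) → All Uncovered (vertices C) → size C ≡ distanceToEnd Ps x → Augmenting
    augment-by-rerouting {x} {y} x∈Ps y∈Ps ¬same xy C C-uncovered size≡ with separate x∈Ps y∈Ps ¬same
    ... | Qa , Qb , Os , Ps↭ , x∈Qa , y∈Qb with ∈-∃++ x∈Qa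
    ...   | p , s , Qa≡ with initial-segment Qa p Qa≡
    ...     | P , sizeP , endP≡ , P⊆Qa with absorb P Qb P∩Qb (subst (λ e → Any (Arc D e) (vertices Qb)) (sym endP≡) (lose y∈Qb xy))
      where
      P∩Qb : Disjoint P Qb
      P∩Qb z z∈P = case-disjoint (disjoint-resp-↭ Ps↭ (proj₂ pack)) z (P⊆Qa z∈P)
        where
        case-disjoint : AllPairs Disjoint (Qa ∷ Qb ∷ Os) → Disjoint Qa Qb
        case-disjoint ((Qa∩Qb ∷ _) ∷ _) = Qa∩Qb
    ...       | R , R↭ , endR≡ = replace (Qa ∷ Qb ∷ []) Os (C ∷ R ∷ []) Ps↭ ((C∩R ∷ []) ∷ [] ∷ [])
      (subst (_≤ k) (↭-length Ps↭) (proj₁ pack)) weight-eq inside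
      (inj₂ (All.lookup C-uncovered (end∈ C)) ∷ inj₁ (subst (λ e → IsEndOf e Ps) (sym endR≡) (end-of Qb∈Ps)) ∷ [])
      where
      Qa∈Ps : Qa ∈ Ps
      Qa∈Ps = ∈-resp-↭ (↭-sym Ps↭) (here refl)
      Qb∈Ps : Qb ∈ Ps
      Qb∈Ps = ∈-resp-↭ (↭-sym Ps↭) (there (here refl))
      in-R : ∀ {z} → z ∈ᵖ R → Covered z (Qa ∷ Qb ∷ [])
      in-R z∈R with ∈-++⁻ (vertices P) (∈-resp-↭ R↭ z∈R)
      ... | inj₁ z∈P = here (P⊆Qa z∈P)
      ... | inj₂ z∈Qb = there (here z∈Qb)
      C∩R : Disjoint C R
      C∩R z z∈C z∈R with in-R z∈R
      ... | here z∈Qa = All.lookup C-uncovered z∈C (covered Qa∈Ps z∈Qa)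
      ... | there (here z∈Qb) = All.lookup C-uncovered z∈C (covered Qb∈Ps z∈Qb)
      inside : ∀ {N z} → N ∈ C ∷ R ∷ [] → z ∈ᵖ N → Covered z (Qa ∷ Qb ∷ []) ⊎ Uncovered z
      inside (here refl) z∈C = inj₂ (All.lookup C-uncovered z∈C)
      inside (there (here refl)) z∈R = inj₁ (in-R z∈R)
      open +-*-Solver
      weight-eq : weight (C ∷ R ∷ []) ≡ weight (Qa ∷ Qb ∷ []) + 1
      weight-eq = begin
        size C + (size R + 0)
          ≡⟨ cong₂ (λ c r → c + (r + 0)) (trans size≡ (distanceToEnd-split p (proj₂ pack) Qa∈Ps Qa≡))
                   (trans (↭-length R↭) (trans (length-++ (vertices P)) (cong (_+ size Qb) sizeP))) ⟩
        suc (length s) + ((suc (length p) + size Qb) + 0)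
          ≡⟨ solve 3 (λ l m b → (con 1 :+ m) :+ (((con 1 :+ l) :+ b) :+ con 0) := ((l :+ (con 1 :+ m)) :+ (b :+ con 0)) :+ con 1)
                   refl (length p) (length s) (size Qb) ⟩
        ((length p + suc (length s)) + (size Qb + 0)) + 1
          ≡⟨ cong (λ a → (a + (size Qb + 0)) + 1) (sym (trans (cong length Qa≡) (length-++ p))) ⟩
        (size Qa + (size Qb + 0)) + 1 ∎
        where open ≡-Reasoning


-- Colour classes and paths

module _ {D : Digraph} where

  private
    V = Vertex D

  transversal : ∀ {Qs : List (Path D)} {P : V → Set} → AllPairs Disjoint Qs → All (λ Q → Any P (vertices Q)) Qs →
    ∃ λ xs → Unique xs × All P xs × All (λ x → Covered x Qs) xs × length xs ≡ length Qs
  transversal [] [] = [] , [] , [] , [] , refl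
  transversal (Q∩ ∷ disjoint) (P-on-Q ∷ P-on-Qs) with find P-on-Q | transversal disjoint P-on-Qs
  ... | x , x∈Q , Px | xs , uniq , Pxs , on-Qs , len =
    x ∷ xs ,
    All.map (λ x′-on-Qs x≡x′ → not-later (subst (λ z → Covered z _) (sym x≡x′) x′-on-Qs)) on-Qs ∷ uniq ,
    Px ∷ Pxs , here x∈Q ∷ All.map there on-Qs , cong suc len
    where
    not-later : ¬ Covered x _
    not-later x-on-Qs with find x-on-Qs
    ... | R , R∈ , x∈R = All.lookup Q∩ R∈ x x∈Q x∈R

  module _ {Qs : List (Path D)} (disjoint : AllPairs Disjoint Qs) where

    distanceToEnd-injective : ∀ {Q x y} → Q ∈ Qs → x ∈ᵖ Q → y ∈ᵖ Q → distanceToEnd Qs x ≡ distanceToEnd Qs y → x ≡ y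
    distanceToEnd-injective Q∈ x∈ y∈ d≡ with ∈-∃++ x∈ | ∈-∃++ y∈
    ... | p , s , Q≡ | p′ , s′ , Q≡′ = ∷-position-injective p s p′ s′ (trans (sym Q≡) Q≡′)
      (suc-injective (trans (sym (distanceToEnd-split p disjoint Q∈ Q≡)) (trans d≡ (distanceToEnd-split p′ disjoint Q∈ Q≡′))))

    vertex-at-distance : ∀ {Q s} → Q ∈ Qs → 1 ≤ s → s ≤ size Q → ∃ λ x → x ∈ᵖ Q × distanceToEnd Qs x ≡ s
    vertex-at-distance {Q} {suc m} Q∈ _ m<size with split-at-suffix-length (vertices Q) m m<size
    ... | p , x , s , Q≡ , len = x , subst (x ∈_) (sym Q≡) (∈-insert p) , trans (distanceToEnd-split p disjoint Q∈ Q≡) (cong suc len)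

  module _ (c : V → ℕ) where

    classSize-≥ : ∀ j {xs} → Unique xs → All (λ x → c x ≡ j) xs → length xs ≤ classSize {D} c j
    classSize-≥ j uniq in-class =
      Unique⇒length≤ uniq λ x∈ → ∈-filter⁺ (λ v → c v ≟ j) (∈-allFin _) (All.lookup in-class x∈)

    module _ {v} (alone : ∀ {x} → c x ≡ c v → x ≡ v) where

      classSize-singleton : classSize {D} c (c v) ≡ 1
      classSize-singleton = filter-length-1 (λ x → c x ≟ c v)
        (AllPairs.map (λ x≢y (cx≡ , cy≡) → x≢y (trans (alone cx≡) (sym (alone cy≡)))) (Unique.allFin⁺ (n D)))
        (lose (∈-allFin v) refl)

      meets-singleton : ∀ {Qs} → AllPairs Disjoint Qs → Covered v Qs → meets {D} c (c v) Qs ≡ 1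
      meets-singleton disjoint v-on = filter-length-1 (λ Q → any? (λ x → c x ≟ c v) (vertices Q))
        (AllPairs.map (λ Q∩R (Q∋ , R∋) → Q∩R v (through Q∋) (through R∋)) disjoint)
        (Any.map (λ v∈ → lose v∈ refl) v-on)
        where
        through : ∀ {xs} → Any (λ x → c x ≡ c v) xs → v ∈ xs
        through any with find any
        ... | x , x∈ , cx≡ = subst (_∈ _) (alone cx≡) x∈

    meets-all : ∀ j Qs → All (λ Q → Any (λ x → c x ≡ j) (vertices Q)) Qs → meets {D} c j Qs ≡ length Qs
    meets-all j Qs all-meet = cong length (filter-all (λ Q → any? (λ x → c x ≟ j) (vertices Q)) all-meet)

-- Heights on the uncovered vertices

module Heights (D : Digraph) (U : Vertex D → Set) (U? : Decidable U) where

  private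
    V = Vertex D

  record Grading : Set where
    field
      height : V → ℕ
      height-pos : ∀ {u} → U u → 1 ≤ height u
      step-down : ∀ {u} → U u → 2 ≤ height u → ∃ λ w → U w × Arc D u w × suc (height w) ≡ height u

  open Grading

  Proper : Grading → Set
  Proper g = ∀ {u w} → U u → U w → Arc D u w → height g u ≢ height g w

  module _ (g : Grading) where

    private
      h = height g

    descending-walk : ∀ m {u} → U u → h u ≡ suc m → Σ (List V) λ ws →
      Walk D (u ∷ ws) × Unique (u ∷ ws) × All U (u ∷ ws) × All (λ z → h z < h u) ws × length ws ≡ m
    descending-walk zero u∈ _ = [] , tt , [] ∷ [] , u∈ ∷ [] , [] , refl
    descending-walk (suc m) {u} u∈ hu≡ with step-down g u∈ (subst (2 ≤_) (sym hu≡) (s≤s (s≤s z≤n)))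
    ... | w , w∈ , uw , hw≡ with descending-walk m w∈ (suc-injective (trans hw≡ hu≡))
    ...   | ws , walk , uniq , inU , below , len =
            w ∷ ws , (uw , walk) , All.tabulate (λ z∈ u≡z → <-irrefl (cong h (sym u≡z)) (All.lookup below′ z∈)) ∷ uniq ,
            u∈ ∷ inU , below′ , cong suc len
      where
      hw<hu : h w < h u
      hw<hu = subst (suc (h w) ≤_) hw≡ ≤-refl
      below′ : All (λ z → h z < h u) (w ∷ ws)
      below′ = hw<hu ∷ All.map (λ hz< → <-trans hz< hw<hu) below

    chain : ∀ {u} → U u → Σ (Path D) λ C → start C ≡ u × size C ≡ h u × All U (vertices C)
    chain {u} u∈ =
      let ws , walk , uniq , inU , _ , len = descending-walk (pred (h u)) u∈ (sym suc-pred-hu)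
      in mkPath (u ∷ ws) uniq walk , refl , trans (cong suc len) suc-pred-hu , inU
      where
      suc-pred-hu : suc (pred (h u)) ≡ h u
      suc-pred-hu = suc-pred (h u) ⦃ >-nonZero (height-pos g u∈) ⦄

    level-below : ∀ d {u m} → U u → 1 ≤ m → h u ≡ d + m → ∃ λ w → U w × h w ≡ m
    level-below zero u∈ _ hu≡ = _ , u∈ , hu≡
    level-below (suc d) {m = m} u∈ 1≤m hu≡ with step-down g u∈ (subst (2 ≤_) (sym hu≡) (s≤s (≤-trans 1≤m (m≤n+m m d))))
    ... | w , w∈ , _ , hw≡ = level-below d w∈ 1≤m (suc-injective (trans hw≡ hu≡))

    path-of-size : ∀ {u m} → U u → 1 ≤ m → m ≤ h u → Σ (Path D) λ C → size C ≡ m × All U (vertices C)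
    path-of-size {u} {m} u∈ 1≤m m≤hu with level-below (h u ∸ m) u∈ 1≤m (sym (m∸n+n≡m m≤hu))
    ... | w , w∈ , hw≡ with chain w∈
    ...   | C , _ , sizeC , inU = C , trans sizeC hw≡ , inU

  constant : Grading
  constant = record { height = λ _ → 1 ; height-pos = λ _ → ≤-refl ; step-down = λ { _ (s≤s ()) } }

  module Raise (g : Grading) {u w} (u∈ : U u) (w∈ : U w) (uw : Arc D u w) (hu≡hw : height g u ≡ height g w) where

    private
      h = height g

    data Descends : V → Set where
      here : Descends u
      step : ∀ {x y} → U x → U y → Arc D x y → suc (h y) ≡ h x → Descends y → Descends x

    Descends⇒≤ : ∀ {x} → Descends x → h u ≤ h x
    Descends⇒≤ here = ≤-refl
    Descends⇒≤ (step {y = y} _ _ _ hy≡ dy) = ≤-trans (Descends⇒≤ dy) (subst (h y ≤_) hy≡ (n≤1+n (h y)))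

    ¬Descends-w : ¬ Descends w
    ¬Descends-w here = noLoop D u uw
    ¬Descends-w (step _ _ _ hy≡ dy) = <-irrefl hu≡hw (≤-trans (s≤s (Descends⇒≤ dy)) (≤-reflexive hy≡))

    Link : V → V → Set
    Link x y = (U x × U y × Arc D x y × suc (h y) ≡ h x) × Descends y

    descends-within : ∀ f x → h x ≤ f → Dec (Descends x)
    link-within : ∀ f x → h x ≤ f → ∀ y → Dec (Link x y)

    descends-within f x hx = map′ from to ((x ≟ᶠ u) ⊎-dec anyᶠ? (link-within f x hx))
      where
      from : x ≡ u ⊎ ∃ (Link x) → Descends x
      from (inj₁ refl) = here
      from (inj₂ (_ , (x∈ , y∈ , xy , hy≡) , dy)) = step x∈ y∈ xy hy≡ dy
      to : Descends x → x ≡ u ⊎ ∃ (Link x)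
      to here = inj₁ refl
      to (step x∈ y∈ xy hy≡ dy) = inj₂ (_ , (x∈ , y∈ , xy , hy≡) , dy)

    link-within f x hx y with U? x ×-dec U? y ×-dec arc? D x y ×-dec (suc (h y) ≟ h x)
    ... | no ¬arc = no (¬arc ∘ proj₁)
    link-within zero x hx y | yes (_ , _ , _ , hy≡) = contradiction (subst (_≤ 0) (sym hy≡) hx) λ ()
    link-within (suc f) x hx y | yes arc@(_ , _ , _ , hy≡) =
      map′ (arc ,_) proj₂ (descends-within f y (≤-pred (subst (_≤ suc f) (sym hy≡) hx)))

    descends? : ∀ x → Dec (Descends x)
    descends? x = descends-within (h x) x ≤-refl

    raised-height : V → ℕ
    raised-height x with descends? x
    ... | yes _ = suc (h x)
    ... | no _ = h x

    raised-yes : ∀ {x} → Descends x → raised-height x ≡ suc (h x)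
    raised-yes {x} dx with descends? x
    ... | yes _ = refl
    ... | no ¬dx = contradiction dx ¬dx

    raised-no : ∀ {x} → ¬ Descends x → raised-height x ≡ h x
    raised-no {x} ¬dx with descends? x
    ... | yes dx = contradiction dx ¬dx
    ... | no _ = refl

    raised-≥ : ∀ x → h x ≤ raised-height x
    raised-≥ x with descends? x
    ... | yes _ = n≤1+n (h x)
    ... | no _ = ≤-refl

    -- A raised vertex steps down to a raised vertex, except u, which now steps down to w.
    raised-step-down : ∀ {x} → U x → 2 ≤ raised-height x → ∃ λ y → U y × Arc D x y × suc (raised-height y) ≡ raised-height x
    raised-step-down {x} x∈ 2≤ with descends? x
    ... | yes here = w , w∈ , uw , cong suc (trans (raised-no ¬Descends-w) (sym hu≡hw))
    ... | yes (step _ y∈ xy hy≡ dy) = _ , y∈ , xy , cong suc (trans (raised-yes dy) hy≡)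
    ... | no ¬dx with step-down g x∈ 2≤
    ...   | y , y∈ , xy , hy≡ = y , y∈ , xy , trans (cong suc (raised-no λ dy → ¬dx (step x∈ y∈ xy hy≡ dy))) hy≡

    raised : Grading
    raised = record
      { height = raised-height
      ; height-pos = λ x∈ → ≤-trans (height-pos g x∈) (raised-≥ _)
      ; step-down = raised-step-down
      }

  potential : ℕ → Grading → ℕ
  potential B g = sum (map (λ x → B ∸ height g x) (allFin (n D)))

  improper? : ∀ g → Dec (∃ λ u → ∃ λ w → U u × U w × Arc D u w × height g u ≡ height g w)
  improper? g = anyᶠ? λ u → anyᶠ? λ w → U? u ×-dec U? w ×-dec arc? D u w ×-dec (height g u ≟ height g w)

  proper-or-tall : ∀ B g → Acc _<_ (potential B g) → Σ Grading Proper ⊎ Σ Grading λ g → ∃ λ u → U u × B < height g u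
  proper-or-tall B g (acc smaller) with improper? g
  ... | no ¬improper = inj₁ (g , λ u∈ w∈ uw hu≡hw → ¬improper (_ , _ , u∈ , w∈ , uw , hu≡hw))
  ... | yes (u , w , u∈ , w∈ , uw , hu≡hw) with suc (height g u) ≤? B
  ...   | no tall = inj₂ (raised , u , u∈ , subst (B <_) (sym (raised-yes here)) (≰⇒> tall))
    where open Raise g u∈ w∈ uw hu≡hw
  ...   | yes fits = proper-or-tall B raised (smaller (sum-map-< _ _ (λ x → ∸-monoʳ-≤ B (raised-≥ x)) (∈-allFin u) decrease))
    where
    open Raise g u∈ w∈ uw hu≡hw
    decrease : B ∸ raised-height u < B ∸ height g u
    decrease = ∸-monoʳ-< (subst (height g u <_) (sym (raised-yes here)) ≤-refl) (subst (_≤ B) (sym (raised-yes here)) fits)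

  grading : ∀ B → Σ Grading Proper ⊎ Σ Grading λ g → ∃ λ u → U u × B < height g u
  grading B = proper-or-tall B constant (<-wellFounded _)

-- The colouring

module Colouring {D : Digraph} (in-semicomplete : InSemicomplete D) {k : ℕ} {Ps : List (Path D)} (pack : IsPack D k Ps) where

  open import Data.List.Membership.DecPropositional (_≟ᶠ_ {n D}) using (_∈?_)
  open Augmentation pack
  private
    V = Vertex D
    disjoint = proj₂ pack

  covered? : ∀ v → Dec (Covered v Ps)
  covered? v = any? (λ Q → v ∈? vertices Q) Ps

  uncovered? : ∀ v → Dec (Uncovered v)
  uncovered? v = ¬? (covered? v)

  samePath? : ∀ x y → Dec (SamePath x y)
  samePath? x y = any? (λ Q → (x ∈? vertices Q) ×-dec (y ∈? vertices Q)) Ps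

  open Heights D Uncovered uncovered? public

  Result : Set
  Result = Σ (V → ℕ) (λ c → IsColoring D c × Orthogonal k c Ps) ⊎ Augmenting

  Full : Set
  Full = ∀ {u} → Uncovered u → length Ps ≡ k

  full-or-augment : Full ⊎ Augmenting
  full-or-augment with anyᶠ? uncovered? | length Ps <? k
  ... | yes (_ , u∉) | yes short = inj₂ (augment-by-singleton u∉ short)
  ... | yes _ | no ¬short = inj₁ λ _ → ≤-antisym (proj₁ pack) (≮⇒≥ ¬short)
  ... | no none | _ = inj₁ λ u∉ → contradiction (_ , u∉) none

  module _ (g : Grading) where

    open Grading g

    Used : ℕ → Set
    Used s = ∃ λ w → Uncovered w × height w ≡ s

    used? : ∀ s → Dec (Used s)
    used? s = anyᶠ? λ w → uncovered? w ×-dec (height w ≟ s)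

    exchange : ∀ {u Q} → Uncovered u → Q ∈ Ps → size Q < height u → Augmenting
    exchange u∉ Q∈ size< with path-of-size g u∉ (s≤s z≤n) size<
    ... | C , size≡ , C∉ = augment-by-exchange Q∈ C C∉ size≡

    NoInsertion NoRerouting NoSplicing NoExchange : Set
    NoInsertion = ∀ {u v} → Uncovered u → Covered v Ps → ¬ Arc D u v
    NoRerouting = ∀ {x y} → Covered x Ps → Covered y Ps → ¬ SamePath x y → Used (distanceToEnd Ps x) → ¬ Arc D x y
    NoSplicing = ∀ {v u} → Covered v Ps → Uncovered u → distanceToEnd Ps v ≡ height u → ¬ Arc D v u
    NoExchange = ∀ {u Q} → Uncovered u → Q ∈ Ps → height u ≤ size Q

    insertion-or-none : Augmenting ⊎ NoInsertion
    insertion-or-none with anyᶠ? (λ u → anyᶠ? λ v → uncovered? u ×-dec covered? v ×-dec arc? D u v)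
    ... | yes (_ , _ , u∉ , v∈ , uv) = inj₁ (augment-by-insertion in-semicomplete u∉ v∈ uv)
    ... | no none = inj₂ λ u∉ v∈ uv → none (_ , _ , u∉ , v∈ , uv)

    rerouting-or-none : Augmenting ⊎ NoRerouting
    rerouting-or-none with anyᶠ? (λ x → anyᶠ? λ y →
      covered? x ×-dec covered? y ×-dec ¬? (samePath? x y) ×-dec used? (distanceToEnd Ps x) ×-dec arc? D x y)
    ... | yes (_ , _ , x∈ , y∈ , ¬same , (w , w∉ , hw≡) , xy) with chain g w∉
    ...   | C , _ , size≡ , C∉ = inj₁ (augment-by-rerouting in-semicomplete x∈ y∈ ¬same xy C C∉ (trans size≡ hw≡))
    rerouting-or-none | no none = inj₂ λ x∈ y∈ ¬same used xy → none (_ , _ , x∈ , y∈ , ¬same , used , xy)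

    splicing-or-none : Augmenting ⊎ NoSplicing
    splicing-or-none with anyᶠ? (λ v → anyᶠ? λ u →
      covered? v ×-dec uncovered? u ×-dec (distanceToEnd Ps v ≟ height u) ×-dec arc? D v u)
    ... | yes (_ , _ , v∈ , u∉ , d≡ , vu) with chain g u∉
    ...   | C , start≡ , size≡ , C∉ =
      inj₁ (augment-by-splicing v∈ C C∉ (subst (Arc D _) (sym start≡) vu) (trans size≡ (sym d≡)))
    splicing-or-none | no none = inj₂ λ v∈ u∉ d≡ vu → none (_ , _ , v∈ , u∉ , d≡ , vu)

    exchange-or-none : Augmenting ⊎ NoExchange
    exchange-or-none with anyᶠ? (λ u → uncovered? u ×-dec any? (λ Q → size Q <? height u) Ps)
    ... | yes (_ , u∉ , short) with find short
    ...   | Q , Q∈ , size< = inj₁ (exchange u∉ Q∈ size<)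
    exchange-or-none | no none = inj₂ λ u∉ Q∈ → ≮⇒≥ λ size< → none (_ , u∉ , lose Q∈ size<)

    level : V → ℕ
    level x with covered? x
    ... | yes _ = distanceToEnd Ps x
    ... | no _ = height x

    level-covered : ∀ {x} → Covered x Ps → level x ≡ distanceToEnd Ps x
    level-covered {x} x∈ with covered? x
    ... | yes _ = refl
    ... | no x∉ = contradiction x∈ x∉

    colour : V → ℕ
    colour x with used? (level x)
    ... | yes _ = 2 * level x
    ... | no _ = suc (2 * toℕ x)

    colour-used : ∀ {x} → Used (level x) → colour x ≡ 2 * level x
    colour-used {x} used with used? (level x)
    ... | yes _ = refl
    ... | no unused = contradiction used unused

    colour-unused : ∀ {x} → ¬ Used (level x) → colour x ≡ suc (2 * toℕ x)
    colour-unused {x} unused with used? (level x)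
    ... | yes used = contradiction used unused
    ... | no _ = refl

    module _ (proper : Proper g) (no-insertion : NoInsertion) (no-rerouting : NoRerouting) (no-splicing : NoSplicing) where

      level-stable : ∀ {x y} → Used (level x) → level x ≡ level y → ¬ Arc D x y
      level-stable {x} {y} used l≡ xy with covered? x | covered? y
      ... | no x∉ | no y∉ = proper x∉ y∉ xy l≡
      ... | no x∉ | yes y∈ = no-insertion x∉ y∈ xy
      ... | yes x∈ | no y∉ = no-splicing x∈ y∉ l≡ xy
      ... | yes x∈ | yes y∈ with samePath? x y
      ...   | no ¬same = no-rerouting x∈ y∈ ¬same used xy
      ...   | yes same with find same
      ...     | Q , Q∈ , x∈Q , y∈Q = noLoop D y (subst (λ z → Arc D z y) (distanceToEnd-injective disjoint Q∈ x∈Q y∈Q l≡) xy)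

      colour-stable : IsColoring D colour
      colour-stable x y c≡ adj with used? (level x) | used? (level y)
      ... | yes ux | yes uy = Data.Sum.[ level-stable ux l≡ , level-stable uy (sym l≡) ] adj
        where
        l≡ = *-cancelˡ-≡ (level x) (level y) 2 c≡
      ... | yes _ | no _ = even≢odd (level x) (toℕ y) c≡
      ... | no _ | yes _ = even≢odd (level y) (toℕ x) (sym c≡)
      ... | no _ | no _ = Data.Sum.[ noLoop D y , noLoop D y ] (subst (λ z → Adjacent D z y) x≡y adj)
        where
        x≡y = toℕ-injective (*-cancelˡ-≡ (toℕ x) (toℕ y) 2 (suc-injective c≡))

    module _ (full : Full) (1≤k : 1 ≤ k) (no-exchange : NoExchange) where

      every-path-meets : ∀ {v} → Used (level v) → All (λ Q → Any (λ x → colour x ≡ colour v) (vertices Q)) Ps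
      every-path-meets {v} used@(w , w∉ , hw≡) = All.tabulate λ Q∈ →
        let x , x∈Q , dx≡ = vertex-at-distance disjoint Q∈ (height-pos w∉) (no-exchange w∉ Q∈)
            lx≡ = trans (level-covered (lose Q∈ x∈Q)) (trans dx≡ hw≡)
        in lose x∈Q (trans (colour-used (subst Used (sym lx≡) used)) (trans (cong (2 *_) lx≡) (sym (colour-used used))))

      orthogonal-used : ∀ {v} → Used (level v) → meets {D} colour (colour v) Ps ≡ classSize {D} colour (colour v) ⊓ k
      orthogonal-used {v} used@(_ , w∉ , _) with transversal disjoint (every-path-meets used)
      ... | xs , uniq , in-class , _ , len =
        trans (meets-all {D} colour (colour v) Ps (every-path-meets used)) (trans (full w∉) (sym (m≥n⇒m⊓n≡n k≤size)))
        where
        k≤size : k ≤ classSize {D} colour (colour v)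
        k≤size = subst (_≤ classSize {D} colour (colour v)) (trans len (full w∉)) (classSize-≥ {D} colour (colour v) uniq in-class)

      orthogonal-unused : ∀ {v} → ¬ Used (level v) → meets {D} colour (colour v) Ps ≡ classSize {D} colour (colour v) ⊓ k
      orthogonal-unused {v} unused =
        trans (meets-singleton {D} colour alone disjoint v∈)
          (sym (trans (cong (_⊓ k) (classSize-singleton {D} colour alone)) (m≤n⇒m⊓n≡m 1≤k)))
        where
        v∈ : Covered v Ps
        v∈ with covered? v
        ... | yes v∈ = v∈
        ... | no v∉ = contradiction (v , v∉ , refl) unused
        alone : ∀ {x} → colour x ≡ colour v → x ≡ v
        alone {x} cx≡ with used? (level x)
        ... | yes _ = contradiction (trans cx≡ (colour-unused unused)) (even≢odd (level x) (toℕ v))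
        ... | no _ = toℕ-injective (*-cancelˡ-≡ (toℕ x) (toℕ v) 2 (suc-injective (trans cx≡ (colour-unused unused))))

      colour-orthogonal : Orthogonal k colour Ps
      colour-orthogonal v = case used? (level v) of λ where
        (yes used) → orthogonal-used used
        (no unused) → orthogonal-unused unused

    exchange-above-weight : Full → 1 ≤ k → ∀ {u} → Uncovered u → weight Ps < height u → Augmenting
    exchange-above-weight full 1≤k u∉ tall with ∃-∈ (subst (1 ≤_) (sym (full u∉)) 1≤k)
    ... | Q , Q∈ = exchange u∉ Q∈ (≤-<-trans (size≤weight Q∈) tall)

    colour-or-augment : Proper g → Full → 1 ≤ k → Result
    colour-or-augment proper full 1≤k with insertion-or-none | rerouting-or-none | splicing-or-none | exchange-or-none
    ... | inj₁ augmenting | _ | _ | _ = inj₂ augmenting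
    ... | inj₂ _ | inj₁ augmenting | _ | _ = inj₂ augmenting
    ... | inj₂ _ | inj₂ _ | inj₁ augmenting | _ = inj₂ augmenting
    ... | inj₂ _ | inj₂ _ | inj₂ _ | inj₁ augmenting = inj₂ augmenting
    ... | inj₂ no-insertion | inj₂ no-rerouting | inj₂ no-splicing | inj₂ no-exchange =
      inj₁ (colour , colour-stable proper no-insertion no-rerouting no-splicing , colour-orthogonal full 1≤k no-exchange)


theorem3p2 : (D : Digraph) → InSemicomplete D → (k : ℕ) → 1 ≤ k →
    (Ps : List (Path D)) → IsPack D k Ps →
    Σ (Vertex D → ℕ) (λ c → IsColoring D c × Orthogonal k c Ps)
    ⊎ Σ (List (Path D)) (λ Qs → IsPack D k Qs × (weight Qs ≡ weight Ps + 1)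
        × All (λ Q → IsEndOf (end Q) Ps ⊎ ¬ Covered (end Q) Ps) Qs)
theorem3p2 D in-semicomplete k 1≤k Ps pack = colouring-or-augmentation
  where
  open Colouring in-semicomplete pack
  colouring-or-augmentation : Result
  colouring-or-augmentation with full-or-augment
  ... | inj₂ augmenting = inj₂ augmenting
  ... | inj₁ full with grading (weight Ps)
  ...   | inj₁ (g , proper) = colour-or-augment g proper full 1≤k
  ...   | inj₂ (g , _ , u∉ , tall) = inj₂ (exchange-above-weight g full 1≤k u∉ tall)
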